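{- For any nonempty partition $\mu$, $d(\mu^r)=d(\mu)-1$ if and only if $\mu_{d(\mu)+1}<d(\mu)$.
   Context: For a partition $\lambda$ set $\lambda_t=0$ for $t>\ell(\lambda)$; $d(\lambda)$ is the largest $i\ge1$ with $\lambda_i\ge i$ (length of the diagonal; $d(\emptyset)=0$). The Maya diagram of $\lambda$ is $S(\lambda)=\{\lambda_t-t+\tfrac12:t\ge1\}$. For $S\subseteq\mathbb{Z}+\tfrac12$ let $S^+=\{x\in S:x>0\}$, $S^-=\{x\in(\mathbb{Z}+\tfrac12)\setminus S:x<0\}$; if finite, $c(S)=|S^+|-|S^-|$ and $\{s-c(S):s\in S\}$ is the Maya diagram of a unique partition, the partition associated to $S$. For nonempty $\mu$ with $S=S(\mu)$, $\mu^r$ is the partition associated to $S\setminus\{\min S^+\}$. -}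

module Defs where

open import Data.Nat as ℕ using (ℕ; zero; suc; _⊔_; _≤ᵇ_)
open import Data.Bool using (if_then_else_)
open import Data.Integer as ℤ using (ℤ; +_; _-_; _+_)
open import Data.List using (List; []; _∷_; length; map; foldr; upTo)
open import Data.List.Relation.Unary.All using (All)
open import Data.List.Relation.Unary.Linked using (Linked)
open import Data.List.Relation.Unary.Unique.Propositional using (Unique)
open import Data.List.Membership.Propositional using (_∈_)
open import Data.Product using (Σ; _×_; ∃; ∃-syntax)
open import Relation.Binary.PropositionalEquality using (_≡_; _≢_)
open import Relation.Nullary using (¬_)
open import Function.Bundles using (_⇔_)

record Partition : Set where
  constructor mkPartition
  field
    parts      : List ℕ
    positive   : All (ℕ._<_ 0) parts
    decreasing : Linked ℕ._≥_ parts
open Partition public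

-- λ_t (1-indexed), with λ_t = 0 for t > ℓ(λ) (and, by convention, for t = 0).
partAt : List ℕ → ℕ → ℕ
partAt []       _             = 0
partAt (x ∷ xs) zero          = 0
partAt (x ∷ xs) (suc zero)    = x
partAt (x ∷ xs) (suc (suc t)) = partAt xs (suc t)

_at_ : Partition → ℕ → ℕ
λ' at t = partAt (parts λ') t

-- d(λ) = largest i ≥ 1 with λ_i ≥ i, 0 if none.  Only i ≤ ℓ(λ) can satisfy
-- λ_i ≥ i ≥ 1, so we take the maximum over i ∈ {1,…,ℓ(λ)}.
d : Partition → ℕ
d λ' = foldr _⊔_ 0 (map (λ i → if i ≤ᵇ (λ' at i) then i else 0)
                        (map suc (upTo (length (parts λ')))))

-- Half-integers: the integer k encodes the half-integer k + 1/2.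
-- So x > 0 ⟺ k ≥ 0 and x < 0 ⟺ k < 0.
HSet : Set₁
HSet = ℤ → Set

-- Maya diagram S(λ) = {λ_t − t + 1/2 : t ≥ 1}, encoded as {λ_t − t}.
Maya : Partition → HSet
Maya λ' k = ∃[ t ] (+ (λ' at suc t) - + suc t ≡ k)

HasCharge : HSet → ℤ → Set
HasCharge S c =
  Σ (List ℤ) λ P → Σ (List ℤ) λ N →
    Unique P × Unique N ×
    (∀ k → (k ∈ P) ⇔ (S k × + 0 ℤ.≤ k)) ×
    (∀ k → (k ∈ N) ⇔ (¬ S k × k ℤ.< + 0)) ×
    (c ≡ + length P - + length N)

AssociatedTo : HSet → Partition → Set
AssociatedTo S ν = ∃[ c ] (HasCharge S c × (∀ k → Maya ν k ⇔ S (k + c)))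

IsMinPos : HSet → ℤ → Set
IsMinPos S m = S m × + 0 ℤ.≤ m × (∀ k → S k → + 0 ℤ.≤ k → m ℤ.≤ k)

IsMuR : Partition → Partition → Set
IsMuR μ ν = ∃[ m ] (IsMinPos (Maya μ) m ×
                    AssociatedTo (λ k → Maya μ k × k ≢ m) ν)

-- Write d(μ) = e + 1 and m_t = μ_{t+1} − (t + 1), a strictly decreasing sequence with
-- S(μ) = {m_t + 1/2}.  The positive part of S(μ) is {m_0, …, m_e}, so S(μ) ∖ {min S(μ)⁺} is
-- enumerated decreasingly by t ↦ m_{punchIn e t}.  Strictly decreasing sequences with the same
-- image coincide, so the Maya sequence of μ^r is t ↦ m_{punchIn e t} − c, and comparing far out,
-- where all rows are empty, forces c = −1.  Hence μ^r is μ with row e + 1 deleted and one box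
-- added to each of the rows 1, …, e: its first e rows still reach the diagonal, and its row
-- e + 1, which is μ_{e+2}, decides whether d(μ^r) is e or e + 1.
module Submission where

open import Defs
open import Data.Nat using (ℕ; _<_; _∸_; _+_)
open import Data.List using ([])
open import Relation.Binary.PropositionalEquality using (_≡_; _≢_)
open import Function.Bundles using (_⇔_)

open import Data.Nat using (zero; suc; _≤_; _≥_; z≤n; s≤s; z<s; _⊔_; _≤ᵇ_; _<?_; _≤?_)
import Data.Nat.Properties as ℕₚ
open import Data.Integer as ℤ using (ℤ; +_; 0ℤ; 1ℤ; -1ℤ)
import Data.Integer.Properties as ℤₚ
open import Data.Integer.Tactic.RingSolver using (solve-∀)
open import Algebra.Properties.AbelianGroup ℤₚ.+-0-abelianGroup using (∙-cancelʳ)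
open import Data.List using (_∷_; length; map; foldr; upTo)
open import Data.List.Relation.Unary.All using (_∷_)
open import Data.List.Relation.Unary.Any using (here; there)
open import Data.List.Relation.Unary.Linked using (Linked; _∷_)
open import Data.List.Membership.Propositional using (_∈_)
open import Data.List.Membership.Propositional.Properties using (∈-upTo⁺; ∈-map⁺)
open import Data.Product using (∃; ∃-syntax; _×_; _,_)
open import Data.Sum using (inj₁; inj₂)
open import Data.Unit using (tt)
open import Data.Bool using (true; false; if_then_else_; T)
open import Relation.Nullary using (yes; no; contradiction)
open import Relation.Binary.PropositionalEquality
  using (refl; sym; trans; cong; subst; module ≡-Reasoning)
open import Relation.Binary.Definitions using (tri<; tri≈; tri>)
open import Function.Base using (_∘_)
open import Function.Bundles using (mk⇔; Equivalence)

open Equivalence using (to; from)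

extendBelow : ∀ {P : ℕ → Set} {k} → (∀ i → i < k → P i) → P k → ∀ i → i < suc k → P i
extendBelow below Pk i (s≤s i≤k) with ℕₚ.m≤n⇒m<n∨m≡n i≤k
... | inj₁ i<k  = below i i<k
... | inj₂ refl = Pk

partAt-≤-head : ∀ x xs → Linked _≥_ (x ∷ xs) → ∀ j → partAt (x ∷ xs) (suc j) ≤ x
partAt-≤-head x xs        _           zero    = ℕₚ.≤-refl
partAt-≤-head x []        _           (suc j) = z≤n
partAt-≤-head x (y ∷ ys) (x≥y ∷ ys↓) (suc j) = ℕₚ.≤-trans (partAt-≤-head y ys ys↓ j) x≥y

partAt-antitone : ∀ xs → Linked _≥_ xs → ∀ {i j} → i ≤ j → partAt xs (suc j) ≤ partAt xs (suc i)
partAt-antitone []           _         _         = z≤n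
partAt-antitone (x ∷ xs)     xs↓       {zero} {j} _ = partAt-≤-head x xs xs↓ j
partAt-antitone (x ∷ [])     _         (s≤s _)   = z≤n
partAt-antitone (x ∷ y ∷ ys) (_ ∷ ys↓) (s≤s i≤j) = partAt-antitone (y ∷ ys) ys↓ i≤j

at-antitone : ∀ λ' {i j} → i ≤ j → λ' at suc j ≤ λ' at suc i
at-antitone λ' = partAt-antitone (parts λ') (decreasing λ')

partAt-beyond : ∀ xs {t} → length xs ≤ t → partAt xs (suc t) ≡ 0
partAt-beyond []           _         = refl
partAt-beyond (x ∷ [])     (s≤s _)   = refl
partAt-beyond (x ∷ y ∷ ys) (s≤s ℓ≤t) = partAt-beyond (y ∷ ys) ℓ≤t

partAt-positive⇒< : ∀ xs {t} → 0 < partAt xs (suc t) → t < length xs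
partAt-positive⇒< xs {t} pos with t <? length xs
... | yes t<ℓ = t<ℓ
... | no  t≮ℓ = contradiction (subst (0 <_) (partAt-beyond xs (ℕₚ.≮⇒≥ t≮ℓ)) pos) (ℕₚ.<-irrefl refl)

at-1-positive : ∀ λ' → parts λ' ≢ [] → 0 < λ' at 1
at-1-positive (mkPartition []      _         _) []≢[] = contradiction refl []≢[]
at-1-positive (mkPartition (x ∷ _) (0<x ∷ _) _) _     = 0<x

-- The diagonal

record HasDiagonal (λ' : Partition) (n : ℕ) : Set where
  constructor diagonal
  field
    reaches : ∀ i → i < n → suc i ≤ λ' at suc i
    stops   : λ' at suc n < suc n

d-term : Partition → ℕ → ℕ
d-term λ' i = if i ≤ᵇ (λ' at i) then i else 0

d-term-≤ : ∀ λ' i → d-term λ' i ≤ i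
d-term-≤ λ' i with i ≤ᵇ (λ' at i)
... | true  = ℕₚ.≤-refl
... | false = z≤n

d-term-on-diagonal : ∀ λ' {i} → i ≤ λ' at i → d-term λ' i ≡ i
d-term-on-diagonal λ' {i} i≤λᵢ with i ≤ᵇ (λ' at i) in eq
... | true  = refl
... | false = contradiction (subst T eq (ℕₚ.≤⇒≤ᵇ i≤λᵢ)) λ ()

d-term-off-diagonal : ∀ λ' {i} → λ' at i < i → d-term λ' i ≡ 0
d-term-off-diagonal λ' {i} λᵢ<i with i ≤ᵇ (λ' at i) in eq
... | true  = contradiction (ℕₚ.≤ᵇ⇒≤ i _ (subst T (sym eq) tt)) (ℕₚ.<⇒≱ λᵢ<i)
... | false = refl

foldr-⊔-lub : ∀ (f : ℕ → ℕ) ys {n} → (∀ y → f y ≤ n) → foldr _⊔_ 0 (map f ys) ≤ n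
foldr-⊔-lub f []       f≤n = z≤n
foldr-⊔-lub f (y ∷ ys) f≤n = ℕₚ.⊔-lub (f≤n y) (foldr-⊔-lub f ys f≤n)

∈⇒≤-foldr-⊔ : ∀ (f : ℕ → ℕ) {ys y} → y ∈ ys → f y ≤ foldr _⊔_ 0 (map f ys)
∈⇒≤-foldr-⊔ f         (here refl)  = ℕₚ.m≤m⊔n (f _) _
∈⇒≤-foldr-⊔ f {z ∷ _} (there y∈ys) = ℕₚ.≤-trans (∈⇒≤-foldr-⊔ f y∈ys) (ℕₚ.m≤n⊔m (f z) _)

hasDiagonal⇒d≡ : ∀ λ' {n} → HasDiagonal λ' n → d λ' ≡ n
hasDiagonal⇒d≡ λ' {n} (diagonal long short) = ℕₚ.≤-antisym d≤n (n≤d n long)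
  where
  indices = map suc (upTo (length (parts λ')))

  term≤n : ∀ y → d-term λ' y ≤ n
  term≤n y with y ≤? n
  term≤n y       | yes y≤n = ℕₚ.≤-trans (d-term-≤ λ' y) y≤n
  term≤n zero    | no  y≰n = contradiction z≤n y≰n
  term≤n (suc y) | no  y≰n = subst (_≤ n) (sym (d-term-off-diagonal λ' row-y-short)) z≤n
    where
    n≤y = ℕₚ.≤-pred (ℕₚ.≰⇒> y≰n)
    row-y-short = ℕₚ.≤-<-trans (at-antitone λ' n≤y) (ℕₚ.<-≤-trans short (s≤s n≤y))

  d≤n : d λ' ≤ n
  d≤n = foldr-⊔-lub (d-term λ') indices term≤n

  n≤d : ∀ k → (∀ i → i < k → suc i ≤ λ' at suc i) → k ≤ d λ'
  n≤d zero    _      = z≤n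
  n≤d (suc k) long-k = ℕₚ.≤-trans (ℕₚ.≤-reflexive (sym (d-term-on-diagonal λ' row-k)))
                                  (∈⇒≤-foldr-⊔ (d-term λ') (∈-map⁺ suc (∈-upTo⁺ k<ℓ)))
    where
    row-k = long-k k ℕₚ.≤-refl
    k<ℓ = partAt-positive⇒< (parts λ') (ℕₚ.<-≤-trans z<s row-k)

-- Scanning rows 1, 2, … for the first one shorter than its index ends by row ℓ(λ) + 1.
diagonal-search : ∀ λ' fuel k → length (parts λ') ≤ fuel + k →
  (∀ i → i < k → suc i ≤ λ' at suc i) → ∃ (HasDiagonal λ')
diagonal-search λ' zero k ℓ≤k long =
  k , diagonal long (subst (_< suc k) (sym (partAt-beyond (parts λ') ℓ≤k)) z<s)
diagonal-search λ' (suc fuel) k ℓ≤fuel+k long with suc k ≤? λ' at suc k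
... | no  ¬long-k = k , diagonal long (ℕₚ.≰⇒> ¬long-k)
... | yes long-k  = diagonal-search λ' fuel (suc k)
                      (subst (length (parts λ') ≤_) (sym (ℕₚ.+-suc fuel k)) ℓ≤fuel+k)
                      (extendBelow long long-k)

hasDiagonal-d : ∀ λ' → HasDiagonal λ' (d λ')
hasDiagonal-d λ' with diagonal-search λ' (length (parts λ')) 0 (ℕₚ.m≤m+n _ 0) (λ _ ())
... | n , diag = subst (HasDiagonal λ') (sym (hasDiagonal⇒d≡ λ' diag)) diag

-- Strictly decreasing integer sequences

StrictlyDecreasing : (ℕ → ℤ) → Set
StrictlyDecreasing a = ∀ {i j} → i < j → a j ℤ.< a i

module _ {a : ℕ → ℤ} (a↓ : StrictlyDecreasing a) where

  strictlyDecreasing⇒antitone : ∀ {i j} → i ≤ j → a j ℤ.≤ a i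
  strictlyDecreasing⇒antitone i≤j with ℕₚ.m≤n⇒m<n∨m≡n i≤j
  ... | inj₁ i<j  = ℤₚ.<⇒≤ (a↓ i<j)
  ... | inj₂ refl = ℤₚ.≤-refl

  strictlyDecreasing⇒injective : ∀ {i j} → a i ≡ a j → i ≡ j
  strictlyDecreasing⇒injective {i} {j} aᵢ≡aⱼ with ℕₚ.<-cmp i j
  ... | tri< i<j _ _ = contradiction (sym aᵢ≡aⱼ) (ℤₚ.<⇒≢ (a↓ i<j))
  ... | tri≈ _ i≡j _ = i≡j
  ... | tri> _ _ j<i = contradiction aᵢ≡aⱼ (ℤₚ.<⇒≢ (a↓ j<i))

-- At the first index t where they might differ, a t = b j for some j ≥ t, so a t ≤ b t;
-- symmetrically b t ≤ a t.
strictlyDecreasing-sameImage⇒≡ : ∀ {a b} → StrictlyDecreasing a → StrictlyDecreasing b →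
  (∀ i → ∃[ j ] a i ≡ b j) → (∀ i → ∃[ j ] b i ≡ a j) → ∀ t → a t ≡ b t
strictlyDecreasing-sameImage⇒≡ {a} {b} a↓ b↓ a⊆b b⊆a t = agreeBelow (suc t) t ℕₚ.≤-refl
  where
  ≤-at-first-difference : ∀ {a b} → StrictlyDecreasing a → StrictlyDecreasing b →
    (∀ i → ∃[ j ] a i ≡ b j) → ∀ t → (∀ i → i < t → a i ≡ b i) → a t ℤ.≤ b t
  ≤-at-first-difference {a} {b} a↓ b↓ a⊆b t agree with a⊆b t
  ... | j , aₜ≡bⱼ with j <? t
  ...   | yes j<t = contradiction
                      (strictlyDecreasing⇒injective a↓ (trans (agree j j<t) (sym aₜ≡bⱼ)))
                      (ℕₚ.<⇒≢ j<t)
  ...   | no  j≮t = subst (ℤ._≤ b t) (sym aₜ≡bⱼ) (strictlyDecreasing⇒antitone b↓ (ℕₚ.≮⇒≥ j≮t))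

  agreeBelow : ∀ t i → i < t → a i ≡ b i
  agreeBelow zero    _ ()
  agreeBelow (suc t) = extendBelow (agreeBelow t) (ℤₚ.≤-antisym
    (≤-at-first-difference a↓ b↓ a⊆b t (agreeBelow t))
    (≤-at-first-difference b↓ a↓ b⊆a t (λ i i<t → sym (agreeBelow t i i<t))))

punchIn : ℕ → ℕ → ℕ
punchIn zero    j       = suc j
punchIn (suc e) zero    = zero
punchIn (suc e) (suc j) = suc (punchIn e j)

punchIn-mono-< : ∀ e {i j} → i < j → punchIn e i < punchIn e j
punchIn-mono-< zero    i<j             = s≤s i<j
punchIn-mono-< (suc e) {zero} {suc j} _ = s≤s z≤n
punchIn-mono-< (suc e) {suc i} (s≤s i<j) = s≤s (punchIn-mono-< e i<j)

punchInᵢ≢i : ∀ e j → punchIn e j ≢ e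
punchInᵢ≢i zero    j       ()
punchInᵢ≢i (suc e) zero    ()
punchInᵢ≢i (suc e) (suc j) eq = punchInᵢ≢i e j (ℕₚ.suc-injective eq)

punchIn-surjective : ∀ e s → s ≢ e → ∃[ j ] punchIn e j ≡ s
punchIn-surjective zero    zero    s≢e = contradiction refl s≢e
punchIn-surjective zero    (suc s) _   = s , refl
punchIn-surjective (suc e) zero    _   = zero , refl
punchIn-surjective (suc e) (suc s) s≢e with punchIn-surjective e s (s≢e ∘ cong suc)
... | j , eq = suc j , cong suc eq

punchIn-< : ∀ e {j} → j < e → punchIn e j ≡ j
punchIn-< (suc e) {zero}  _         = refl
punchIn-< (suc e) {suc j} (s≤s j<e) = cong suc (punchIn-< e j<e)

punchIn-≥ : ∀ e {j} → e ≤ j → punchIn e j ≡ suc j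
punchIn-≥ zero    _         = refl
punchIn-≥ (suc e) (s≤s e≤j) = cong suc (punchIn-≥ e e≤j)

-- Maya diagrams

maya : Partition → ℕ → ℤ
maya λ' t = + (λ' at suc t) ℤ.- + suc t

maya-strictlyDecreasing : ∀ λ' → StrictlyDecreasing (maya λ')
maya-strictlyDecreasing λ' i<j =
  ℤₚ.+-mono-≤-< (ℤ.+≤+ (at-antitone λ' (ℕₚ.<⇒≤ i<j))) (ℤₚ.neg-mono-< (ℤ.+<+ (s≤s i<j)))

maya-nonnegative⇔ : ∀ λ' t → (0ℤ ℤ.≤ maya λ' t) ⇔ (suc t ≤ λ' at suc t)
maya-nonnegative⇔ λ' t = mk⇔ (ℤₚ.drop‿+≤+ ∘ ℤₚ.0≤i-j⇒j≤i) (ℤₚ.i≤j⇒0≤j-i ∘ ℤ.+≤+)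

maya-beyond : ∀ λ' {t} → length (parts λ') ≤ t → maya λ' t ≡ 0ℤ ℤ.- + suc t
maya-beyond λ' {t} ℓ≤t = cong (λ r → + r ℤ.- + suc t) (partAt-beyond (parts λ') ℓ≤t)

maya≡⇒row≡ : ∀ λ' t {r} → maya λ' t ≡ + r ℤ.- + suc t → λ' at suc t ≡ r
maya≡⇒row≡ λ' t eq = ℤₚ.+-injective (∙-cancelʳ (ℤ.- + suc t) _ _ eq)

minPositive-maya : ∀ μ {e m} → HasDiagonal μ (suc e) → IsMinPos (Maya μ) m → m ≡ maya μ e
minPositive-maya μ {e} (diagonal long short) ((s , refl) , 0≤mₛ , minimal) =
  ℤₚ.≤-antisym mₛ≤mₑ mₑ≤mₛ
  where
  mₛ≤mₑ = minimal (maya μ e) (e , refl) (from (maya-nonnegative⇔ μ e) (long e ℕₚ.≤-refl))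

  s≤e : s ≤ e
  s≤e with s ≤? e
  ... | yes s≤e = s≤e
  ... | no  s≰e = contradiction
          (ℕₚ.≤-trans (to (maya-nonnegative⇔ μ s) 0≤mₛ) (at-antitone μ e<s))
          (ℕₚ.<⇒≱ (ℕₚ.<-≤-trans short (s≤s e<s)))
    where e<s = ℕₚ.≰⇒> s≰e

  mₑ≤mₛ = strictlyDecreasing⇒antitone (maya-strictlyDecreasing μ) s≤e

maya-punchIn-enumerates : ∀ λ' e k →
  (Maya λ' k × k ≢ maya λ' e) ⇔ (∃[ j ] maya λ' (punchIn e j) ≡ k)
maya-punchIn-enumerates λ' e k = mk⇔ enumerate (λ (j , eq) → (punchIn e j , eq) , skipped j eq)
  where
  inj = strictlyDecreasing⇒injective (maya-strictlyDecreasing λ')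

  enumerate : Maya λ' k × k ≢ maya λ' e → ∃[ j ] maya λ' (punchIn e j) ≡ k
  enumerate ((s , refl) , mₛ≢mₑ) with punchIn-surjective e s (λ s≡e → mₛ≢mₑ (cong (maya λ') s≡e))
  ... | j , refl = j , refl

  skipped : ∀ j → maya λ' (punchIn e j) ≡ k → k ≢ maya λ' e
  skipped j refl k≡mₑ = punchInᵢ≢i e j (inj k≡mₑ)

associated-maya : ∀ {S : HSet} {y : ℕ → ℤ} {ν c} → StrictlyDecreasing y →
  (∀ k → S k ⇔ (∃[ j ] y j ≡ k)) → (∀ k → Maya ν k ⇔ S (k ℤ.+ c)) →
  ∀ t → maya ν t ≡ y t ℤ.- c
associated-maya {S} {y} {ν} {c} y↓ enum shift =
  strictlyDecreasing-sameImage⇒≡ (maya-strictlyDecreasing ν) y-c↓ maya⊆y-c y-c⊆maya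
  where
  [k+c]-c≡k : ∀ k c → (k ℤ.+ c) ℤ.- c ≡ k
  [k+c]-c≡k = solve-∀

  [k-c]+c≡k : ∀ k c → (k ℤ.- c) ℤ.+ c ≡ k
  [k-c]+c≡k = solve-∀

  y-c↓ : StrictlyDecreasing (λ t → y t ℤ.- c)
  y-c↓ i<j = ℤₚ.+-monoˡ-< (ℤ.- c) (y↓ i<j)

  maya⊆y-c : ∀ i → ∃[ j ] maya ν i ≡ y j ℤ.- c
  maya⊆y-c i with to (enum _) (to (shift (maya ν i)) (i , refl))
  ... | j , eq = j , trans (sym ([k+c]-c≡k (maya ν i) c)) (cong (ℤ._- c) (sym eq))

  y-c⊆maya : ∀ i → ∃[ j ] y i ℤ.- c ≡ maya ν j
  y-c⊆maya i with from (shift (y i ℤ.- c)) (subst S (sym ([k-c]+c≡k (y i) c)) yᵢ∈S)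
    where yᵢ∈S = from (enum (y i)) (i , refl)
  ... | j , eq = j , sym eq

punchIn-shift-charge : ∀ μ ν e c → (∀ t → maya ν t ≡ maya μ (punchIn e t) ℤ.- c) → c ≡ -1ℤ
punchIn-shift-charge μ ν e c shift = x+1≡x-c⇒c≡-1 (0ℤ ℤ.- + suc (suc far)) c (begin
  (0ℤ ℤ.- + suc (suc far)) ℤ.+ 1ℤ       ≡⟨ -[2+t]+1≡-[1+t] (+ far) ⟩
  0ℤ ℤ.- + suc far                      ≡⟨ maya-beyond ν ℓν≤far ⟨
  maya ν far                            ≡⟨ shift far ⟩
  maya μ (punchIn e far) ℤ.- c          ≡⟨ cong (λ s → maya μ s ℤ.- c) (punchIn-≥ e e≤far) ⟩
  maya μ (suc far) ℤ.- c                ≡⟨ cong (ℤ._- c) (maya-beyond μ (ℕₚ.m≤n⇒m≤1+n ℓμ≤far)) ⟩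
  (0ℤ ℤ.- + suc (suc far)) ℤ.- c        ∎)
  where
  open ≡-Reasoning
  ℓν = length (parts ν)
  ℓμ = length (parts μ)
  far = ℓν + (ℓμ + e)
  ℓν≤far = ℕₚ.m≤m+n ℓν _
  ℓμ≤far = ℕₚ.≤-trans (ℕₚ.m≤m+n ℓμ e) (ℕₚ.m≤n+m _ ℓν)
  e≤far  = ℕₚ.≤-trans (ℕₚ.m≤n+m e ℓμ) (ℕₚ.m≤n+m _ ℓν)

  -[2+t]+1≡-[1+t] : ∀ t → (0ℤ ℤ.- (1ℤ ℤ.+ (1ℤ ℤ.+ t))) ℤ.+ 1ℤ ≡ 0ℤ ℤ.- (1ℤ ℤ.+ t)
  -[2+t]+1≡-[1+t] = solve-∀

  x+1≡x-c⇒c≡-1 : ∀ x c → x ℤ.+ 1ℤ ≡ x ℤ.- c → c ≡ -1ℤ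
  x+1≡x-c⇒c≡-1 x c eq = begin
    c                     ≡⟨ c≡x-[x-c] x c ⟩
    x ℤ.- (x ℤ.- c)       ≡⟨ cong (λ z → x ℤ.- z) eq ⟨
    x ℤ.- (x ℤ.+ 1ℤ)      ≡⟨ x-[x+1]≡-1 x ⟩
    -1ℤ                   ∎
    where
    c≡x-[x-c] : ∀ x c → c ≡ x ℤ.- (x ℤ.- c)
    c≡x-[x-c] = solve-∀
    x-[x+1]≡-1 : ∀ x → x ℤ.- (x ℤ.+ 1ℤ) ≡ -1ℤ
    x-[x+1]≡-1 = solve-∀

-- The rows of μ^r

record MuRRows (μ : Partition) (e : ℕ) (ν : Partition) : Set where
  constructor muRRows
  field
    grow  : ∀ t → t < e → ν at suc t ≡ suc (μ at suc t)
    slide : ∀ t → e ≤ t → ν at suc t ≡ μ at suc (suc t)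

muR-rows : ∀ μ ν {e} → HasDiagonal μ (suc e) → IsMuR μ ν → MuRRows μ e ν
muR-rows μ ν {e} diag (m , minPos , c , _ , associated)
  with minPositive-maya μ diag minPos
... | refl = muRRows grow slide
  where
  shift : ∀ t → maya ν t ≡ maya μ (punchIn e t) ℤ.- c
  shift = associated-maya {S = λ k → Maya μ k × k ≢ maya μ e} {ν = ν} {c = c}
                          (maya-strictlyDecreasing μ ∘ punchIn-mono-< e)
                          (maya-punchIn-enumerates μ e) associated

  shift-by-one : ∀ t → maya ν t ≡ maya μ (punchIn e t) ℤ.+ 1ℤ
  shift-by-one t = trans (shift t) (cong (λ c → maya μ (punchIn e t) ℤ.- c)
                                         (punchIn-shift-charge μ ν e c shift))

  [p-q]+1≡[1+p]-q : ∀ p q → (p ℤ.- q) ℤ.+ 1ℤ ≡ (1ℤ ℤ.+ p) ℤ.- q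
  [p-q]+1≡[1+p]-q = solve-∀

  [p-[2+t]]+1≡p-[1+t] : ∀ p t → (p ℤ.- (1ℤ ℤ.+ (1ℤ ℤ.+ t))) ℤ.+ 1ℤ ≡ p ℤ.- (1ℤ ℤ.+ t)
  [p-[2+t]]+1≡p-[1+t] = solve-∀

  grow : ∀ t → t < e → ν at suc t ≡ suc (μ at suc t)
  grow t t<e = maya≡⇒row≡ ν t (begin
    maya ν t                      ≡⟨ shift-by-one t ⟩
    maya μ (punchIn e t) ℤ.+ 1ℤ   ≡⟨ cong (λ s → maya μ s ℤ.+ 1ℤ) (punchIn-< e t<e) ⟩
    maya μ t ℤ.+ 1ℤ               ≡⟨ [p-q]+1≡[1+p]-q (+ (μ at suc t)) (+ suc t) ⟩
    + suc (μ at suc t) ℤ.- + suc t ∎)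
    where open ≡-Reasoning

  slide : ∀ t → e ≤ t → ν at suc t ≡ μ at suc (suc t)
  slide t e≤t = maya≡⇒row≡ ν t (begin
    maya ν t                      ≡⟨ shift-by-one t ⟩
    maya μ (punchIn e t) ℤ.+ 1ℤ   ≡⟨ cong (λ s → maya μ s ℤ.+ 1ℤ) (punchIn-≥ e e≤t) ⟩
    maya μ (suc t) ℤ.+ 1ℤ         ≡⟨ [p-[2+t]]+1≡p-[1+t] (+ (μ at suc (suc t))) (+ t) ⟩
    + (μ at suc (suc t)) ℤ.- + suc t ∎)
    where open ≡-Reasoning

muR-rows-reach-diagonal : ∀ {μ ν e} → HasDiagonal μ (suc e) → MuRRows μ e ν →
  ∀ i → i < e → suc i ≤ ν at suc i
muR-rows-reach-diagonal (diagonal long _) (muRRows grow _) i i<e =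
  subst (suc i ≤_) (sym (grow i i<e)) (ℕₚ.m≤n⇒m≤1+n (long i (ℕₚ.m≤n⇒m≤1+n i<e)))

muR-diagonal : ∀ {μ ν e} → HasDiagonal μ (suc e) → MuRRows μ e ν →
  (d ν ≡ e) ⇔ (μ at suc (suc e) < suc e)
muR-diagonal {μ} {ν} {e} diag@(diagonal _ short) rows@(muRRows _ slide)
  with μ at suc (suc e) <? suc e
... | yes μₑ₊₂-short =
  mk⇔ (λ _ → μₑ₊₂-short) (λ _ → hasDiagonal⇒d≡ ν (diagonal ν-reaches νₑ₊₁-short))
  where
  ν-reaches = muR-rows-reach-diagonal diag rows
  νₑ₊₁-short = subst (_< suc e) (sym (slide e ℕₚ.≤-refl)) μₑ₊₂-short
... | no  μₑ₊₂-long = mk⇔ (λ dν≡e → contradiction (trans (sym dν≡e+1) dν≡e) ℕₚ.1+n≢n)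
                          (λ μₑ₊₂-short → contradiction μₑ₊₂-short μₑ₊₂-long)
  where
  νₑ₊₁-long = subst (suc e ≤_) (sym (slide e ℕₚ.≤-refl)) (ℕₚ.≤-pred (ℕₚ.≰⇒> μₑ₊₂-long))
  νₑ₊₂-short = subst (_< suc (suc e)) (sym (slide (suc e) (ℕₚ.n≤1+n e)))
                     (ℕₚ.≤-<-trans (at-antitone μ (ℕₚ.n≤1+n (suc e))) short)
  ν-reaches = extendBelow (muR-rows-reach-diagonal diag rows) νₑ₊₁-long
  dν≡e+1 = hasDiagonal⇒d≡ ν (diagonal ν-reaches νₑ₊₂-short)

lemma5p14 : (μ ν : Partition) → parts μ ≢ [] → IsMuR μ ν →
    (d ν ≡ d μ ∸ 1) ⇔ (μ at (d μ + 1) < d μ)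
lemma5p14 μ ν μ≢[] μʳ with d μ | hasDiagonal-d μ
... | zero  | diagonal _ μ₁<1 = contradiction (at-1-positive μ μ≢[]) (ℕₚ.<⇒≱ μ₁<1)
... | suc e | diag rewrite ℕₚ.+-comm e 1 = muR-diagonal diag (muR-rows μ ν diag μʳ)
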